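{- Let $k\ge2$ be an integer and let $c_n$ denote the minimal Colless index over rooted binary trees with $n$ leaves. Then $$\max\{c_n: 2^{k-1}<n<2^k\}<2^{k-1}.$$
   Context: A rooted binary tree with $n\ge2$ leaves is a rooted tree in which the root has degree 2 and every other internal vertex has degree 3 (each internal vertex has exactly two children); the single vertex is the rooted binary tree with one leaf. For a vertex $v$, $\kappa_T(v)$ is the number of leaves descending from $v$ ($1$ if $v$ is a leaf). For an internal vertex $v$ with children $v_1,v_2$, $bal_T(v)=|\kappa_T(v_1)-\kappa_T(v_2)|$, and the Colless index is $\mathcal{C}(T)=\sum_{v\text{ internal}} bal_T(v)$. -}

module Defs where

open import Data.Nat using (ℕ; suc; _+_; _≤_; _∸_)
open import Data.Product using (Σ; _×_; _,_)
open import Relation.Binary.PropositionalEquality using (_≡_)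

data Tree : Set where
  leaf : Tree
  node : Tree → Tree → Tree

leaves : Tree → ℕ
leaves leaf       = 1
leaves (node l r) = leaves l + leaves r

absDiff : ℕ → ℕ → ℕ
absDiff a b = (a ∸ b) + (b ∸ a)

colless : Tree → ℕ
colless leaf       = 0
colless (node l r) = absDiff (leaves l) (leaves r) + colless l + colless r

IsMinColless : ℕ → ℕ → Set
IsMinColless n c =
  Σ Tree (λ T → leaves T ≡ n × colless T ≡ c)
  × ((T : Tree) → leaves T ≡ n → c ≤ colless T)

-- For 2^(k-1) < n < 2^k, join a perfect tree with 2^(k-1) leaves and a
-- maximally balanced tree with m = n - 2^(k-1) leaves. The root contributes
-- 2^(k-1) - m, the perfect tree nothing, and the balanced tree at most m - 1,
-- since each of its m - 1 internal vertices splits its leaves into halves.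
-- The total is below 2^(k-1), and c_n exists because only finitely many
-- trees have n leaves.
module Submission where

open import Defs
open import Data.Nat using (ℕ; zero; suc; _+_; _∸_; _^_; _<_; _≤_; z≤n; s≤s; ⌊_/2⌋; ⌈_/2⌉; _≟_)
open import Data.Nat.Induction using (<-rec)
open import Data.Nat.Properties
open import Data.Product using (Σ; _×_; _,_)
open import Data.List using (List; []; _∷_; filter; cartesianProductWith)
open import Data.List.Extrema.Nat using (argmin; argmin-all; f[argmin]≤f[⊤]; f[argmin]≤f[xs])
open import Data.List.Membership.Propositional using (_∈_)
open import Data.List.Membership.Propositional.Properties
  using (∈-cartesianProductWith⁺; ∈-filter⁺)
open import Data.List.Relation.Unary.All using (lookup)
open import Data.List.Relation.Unary.All.Properties using (all-filter)
open import Data.List.Relation.Unary.Any using (here; there)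
open import Relation.Binary.PropositionalEquality using (_≡_; refl; sym; trans; cong; cong₂; subst; module ≡-Reasoning)
open import Relation.Nullary using (contradiction)

0<leaves : ∀ T → 0 < leaves T
0<leaves leaf       = s≤s z≤n
0<leaves (node l r) = ≤-trans (0<leaves l) (m≤m+n (leaves l) (leaves r))

absDiff-≥ : ∀ {m n} → n ≤ m → absDiff m n ≡ m ∸ n
absDiff-≥ {m} {n} n≤m = trans (cong (m ∸ n +_) (m≤n⇒m∸n≡0 n≤m)) (+-identityʳ (m ∸ n))

treesUpTo : ℕ → List Tree
treesUpTo zero    = []
treesUpTo (suc s) = leaf ∷ cartesianProductWith node (treesUpTo s) (treesUpTo s)

∈-treesUpTo : ∀ {s} T → leaves T ≤ s → T ∈ treesUpTo s
∈-treesUpTo {zero}  T          p = contradiction p (<⇒≱ (0<leaves T))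
∈-treesUpTo {suc s} leaf       _ = here refl
∈-treesUpTo {suc s} (node l r) p = there (∈-cartesianProductWith⁺ node
  (∈-treesUpTo l (≤-pred (<-≤-trans (m<m+n (leaves l) (0<leaves r)) p)))
  (∈-treesUpTo r (≤-pred (<-≤-trans (m<n+m (leaves r) (0<leaves l)) p))))

minColless-exists : ∀ {n} T → leaves T ≡ n →
  Σ ℕ λ c → IsMinColless n c × c ≤ colless T
minColless-exists {n} T leaves-T =
  colless T* , ((T* , leaves-T* , refl) , minimal) , f[argmin]≤f[⊤] {f = colless} T candidates
  where
  candidates : List Tree
  candidates = filter (λ T′ → leaves T′ ≟ n) (treesUpTo n)

  T* : Tree
  T* = argmin colless T candidates

  leaves-T* : leaves T* ≡ n
  leaves-T* = argmin-all colless {P = λ T′ → leaves T′ ≡ n} leaves-T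
    (all-filter (λ T′ → leaves T′ ≟ n) (treesUpTo n))

  minimal : ∀ T′ → leaves T′ ≡ n → colless T* ≤ colless T′
  minimal T′ e = lookup (f[argmin]≤f[xs] {f = colless} T candidates)
    (∈-filter⁺ (λ T″ → leaves T″ ≟ n) (∈-treesUpTo T′ (≤-reflexive e)) e)

perfect : ℕ → Tree
perfect zero    = leaf
perfect (suc j) = node (perfect j) (perfect j)

leaves-perfect : ∀ j → leaves (perfect j) ≡ 2 ^ j
leaves-perfect zero    = refl
leaves-perfect (suc j) = cong₂ _+_ (leaves-perfect j) (trans (leaves-perfect j) (sym (+-identityʳ _)))

colless-perfect : ∀ j → colless (perfect j) ≡ 0
colless-perfect zero    = refl
colless-perfect (suc j) rewrite colless-perfect j | n∸n≡0 (leaves (perfect j)) = refl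

colless-perfect-node : ∀ j T → leaves T ≤ 2 ^ j →
  colless (node (perfect j) T) ≡ 2 ^ j ∸ leaves T + colless T
colless-perfect-node j T T≤2ʲ = cong (_+ colless T) (begin
  absDiff (leaves (perfect j)) (leaves T) + colless (perfect j)
    ≡⟨ cong₂ (λ p c → absDiff p (leaves T) + c) (leaves-perfect j) (colless-perfect j) ⟩
  absDiff (2 ^ j) (leaves T) + 0
    ≡⟨ +-identityʳ _ ⟩
  absDiff (2 ^ j) (leaves T)
    ≡⟨ absDiff-≥ T≤2ʲ ⟩
  2 ^ j ∸ leaves T ∎)
  where open ≡-Reasoning

absDiff⌈n/2⌉⌊n/2⌋≤1 : ∀ n → absDiff ⌈ n /2⌉ ⌊ n /2⌋ ≤ 1
absDiff⌈n/2⌉⌊n/2⌋≤1 zero          = z≤n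
absDiff⌈n/2⌉⌊n/2⌋≤1 (suc zero)    = ≤-refl
absDiff⌈n/2⌉⌊n/2⌋≤1 (suc (suc n)) = absDiff⌈n/2⌉⌊n/2⌋≤1 n

BalancedTree : ℕ → Set
BalancedTree m = Σ Tree λ T → leaves T ≡ suc m × colless T ≤ m

balancedTree : ∀ m → BalancedTree m
balancedTree = <-rec BalancedTree split
  where
  split : ∀ m → (∀ {i} → i < m → BalancedTree i) → BalancedTree m
  split zero    _   = leaf , refl , z≤n
  split (suc k) rec with rec (s≤s (⌈n/2⌉≤n k)) | rec (s≤s (⌊n/2⌋≤n k))
  ... | l , leaves-l , colless-l | r , leaves-r , colless-r =
    node l r , leaves-lr , colless-lr
    where
    halves : ⌈ k /2⌉ + ⌊ k /2⌋ ≡ k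
    halves = trans (+-comm ⌈ k /2⌉ ⌊ k /2⌋) (⌊n/2⌋+⌈n/2⌉≡n k)

    leaves-lr : leaves l + leaves r ≡ suc (suc k)
    leaves-lr = trans (cong₂ _+_ leaves-l leaves-r)
                      (cong suc (trans (+-suc ⌈ k /2⌉ ⌊ k /2⌋) (cong suc halves)))

    colless-lr : colless (node l r) ≤ suc k
    colless-lr rewrite leaves-l | leaves-r =
      ≤-trans (+-mono-≤ (+-mono-≤ (absDiff⌈n/2⌉⌊n/2⌋≤1 k) colless-l) colless-r)
              (≤-reflexive (cong suc halves))

lowCollessTree : ∀ j n → 2 ^ j < n → n < 2 ^ suc j →
  Σ Tree λ T → leaves T ≡ n × colless T < 2 ^ j
lowCollessTree j n 2ʲ<n n<2ʲ⁺¹ with m≤n⇒∃[o]m+o≡n 2ʲ<n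
... | m , refl with balancedTree m
...   | B , leaves-B , colless-B = node (perfect j) B , leaves-T , colless-T
  where
  m<2ʲ : m < 2 ^ j
  m<2ʲ = subst (m <_) (+-identityʳ (2 ^ j)) (+-cancelˡ-< (2 ^ j) m (2 ^ j + 0) (<⇒≤ n<2ʲ⁺¹))

  B≤2ʲ : leaves B ≤ 2 ^ j
  B≤2ʲ = subst (_≤ 2 ^ j) (sym leaves-B) m<2ʲ

  leaves-T : leaves (perfect j) + leaves B ≡ suc (2 ^ j + m)
  leaves-T = trans (cong₂ _+_ (leaves-perfect j) leaves-B) (+-suc (2 ^ j) m)

  colless-T : colless (node (perfect j) B) < 2 ^ j
  colless-T = begin-strict
    colless (node (perfect j) B)  ≡⟨ colless-perfect-node j B B≤2ʲ ⟩
    2 ^ j ∸ leaves B + colless B  ≡⟨ cong (λ l → 2 ^ j ∸ l + colless B) leaves-B ⟩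
    2 ^ j ∸ suc m + colless B     <⟨ +-monoʳ-< (2 ^ j ∸ suc m) (s≤s colless-B) ⟩
    2 ^ j ∸ suc m + suc m         ≡⟨ m∸n+n≡m m<2ʲ ⟩
    2 ^ j                         ∎
    where open ≤-Reasoning

lemma8 : (k : ℕ) → 2 ≤ k →
    (n : ℕ) → 2 ^ (k ∸ 1) < n → n < 2 ^ k →
    Σ ℕ (λ c → IsMinColless n c × c < 2 ^ (k ∸ 1))
lemma8 zero    _ n 1<n n<1 = contradiction 1<n (<-asym n<1)
lemma8 (suc j) _ n 2ʲ<n n<2ʲ⁺¹ =
  let T , leaves-T , colless-T = lowCollessTree j n 2ʲ<n n<2ʲ⁺¹
      c , c-min , c≤colless-T  = minColless-exists T leaves-T
  in  c , c-min , ≤-<-trans c≤colless-T colless-T
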